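{- Let $k\ge 1$ and let $G_k$ be the vertex-weighted undirected graph defined below, with terminal set $T=\{a_1,\dots,a_k\}\cup\{d_1,\dots,d_k\}$. Let $i\in\{1,\dots,k\}$ and let $X\subseteq T$ satisfy $a_i\in X$ and $d_i\in T\setminus X$. Then every minimum-weight $(X,T\setminus X)$-vertex-cut in $G_k$ contains $a_i$.
   Context: $G_k$ has terminals $a_1,\dots,a_k,d_1,\dots,d_k$ with weights $w(a_i)=2$, $w(d_i)=4$, an edge $\{a_i,d_i\}$ for each $i$, and for every unordered pair $\{i,j\}$ of distinct indices in $\{1,\dots,k\}$ a non-terminal $v_{i,j}$ of weight $1$ adjacent to exactly $a_i$ and $a_j$. For $A,B\subseteq V$, an $(A,B)$-vertex-cut is a set $C$ of vertices (possibly containing terminals) such that for all $a\in A\setminus C$, $b\in B\setminus C$ there is no path from $a$ to $b$ in $G_k\setminus C$; its weight is $\sum_{v\in C}w(v)$, and a minimum $(A,B)$-vertex-cut is one of minimum weight. -}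

module Defs where

open import Data.Nat using (ℕ; zero; suc; _+_; _*_; _≤_)
open import Data.Fin using (Fin; zero; suc; toℕ; Fin′; inject)
open import Data.Bool using (Bool; true; false; if_then_else_)
open import Data.Product using (_×_)
open import Relation.Binary.PropositionalEquality using (_≡_)
open import Relation.Nullary using (¬_)

-- Vertices of G_k.  The non-terminal v_{i,j} for the unordered pair {i,j}
-- is represented once, as  v i j  with  j : Fin′ i  (i.e. j < i), whose
-- second endpoint index is  inject j : Fin k.
data Vertex (k : ℕ) : Set where
  a : Fin k → Vertex k
  d : Fin k → Vertex k
  v : (i : Fin k) → Fin′ i → Vertex k

w : ∀ {k} → Vertex k → ℕ
w (a _)   = 2
w (d _)   = 4
w (v _ _) = 1

data IsTerminal {k : ℕ} : Vertex k → Set where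
  term-a : ∀ i → IsTerminal (a i)
  term-d : ∀ i → IsTerminal (d i)

data Adj {k : ℕ} : Vertex k → Vertex k → Set where
  ad  : ∀ i → Adj (a i) (d i)
  da  : ∀ i → Adj (d i) (a i)
  av₁ : ∀ i j → Adj (a i) (v i j)
  va₁ : ∀ i j → Adj (v i j) (a i)
  av₂ : ∀ i j → Adj (a (inject j)) (v i j)
  va₂ : ∀ i j → Adj (v i j) (a (inject j))

VSet : ℕ → Set
VSet k = Vertex k → Bool

sumFin : ∀ n → (Fin n → ℕ) → ℕ
sumFin zero    f = 0
sumFin (suc n) f = f zero + sumFin n (λ x → f (suc x))

wIn : ∀ {k} → VSet k → Vertex k → ℕ
wIn C x = if C x then w x else 0

weight : ∀ {k} → VSet k → ℕ
weight {k} C =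
  sumFin k (λ i → wIn C (a i)) +
  sumFin k (λ i → wIn C (d i)) +
  sumFin k (λ i → sumFin (toℕ i) (λ j → wIn C (v i j)))

data Path {k : ℕ} (C : VSet k) : Vertex k → Vertex k → Set where
  here : ∀ {x} → C x ≡ false → Path C x x
  step : ∀ {x y z} → C x ≡ false → Adj x y → Path C y z → Path C x z

IsCut : ∀ {k} → (A B : Vertex k → Set) → VSet k → Set
IsCut A B C = ∀ x y → A x → C x ≡ false → B y → C y ≡ false → ¬ Path C x y

IsMinCut : ∀ {k} → (A B : Vertex k → Set) → VSet k → Set
IsMinCut A B C = IsCut A B C × (∀ C′ → IsCut A B C′ → weight C ≤ weight C′)

InX : ∀ {k} → VSet k → Vertex k → Set
InX X x = IsTerminal x × X x ≡ true

InTminusX : ∀ {k} → VSet k → Vertex k → Set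
InTminusX X x = IsTerminal x × X x ≡ false

-- If a minimum cut C omits a_i, it must contain d_i, since otherwise the edge
-- a_i d_i joins X to T \ X.  Trading d_i (weight 4) for a_i (weight 2) still
-- gives a cut: d_i is a leaf hanging off a_i, so once a_i is removed no path
-- from X (which does not contain d_i) can reach or pass through d_i.  The
-- trade lowers the weight by 2, contradicting minimality.
module Submission where

open import Defs
open import Data.Nat using (ℕ; zero; suc; _+_; _≤_; _<_; s≤s; z≤n)
open import Data.Nat.Properties using (+-assoc; +-identityʳ; m<m+n; <⇒≱)
open import Data.Nat.Solver using (module +-*-Solver)
open import Data.Fin using (Fin; zero; suc; toℕ; _≟_)
open import Data.Fin.Properties using (suc-injective)
open import Data.Bool using (true; false; if_then_else_)
open import Data.Product using (_,_; proj₂)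
open import Data.Empty using (⊥-elim)
open import Relation.Nullary using (yes; no)
open import Function using (_∘_)
open import Relation.Binary.PropositionalEquality

sumFin-cong : ∀ n {f g : Fin n → ℕ} → (∀ j → f j ≡ g j) → sumFin n f ≡ sumFin n g
sumFin-cong zero    f≗g = refl
sumFin-cong (suc n) f≗g = cong₂ _+_ (f≗g zero) (sumFin-cong n (λ j → f≗g (suc j)))

sumFin-update : ∀ n (i : Fin n) {f g : Fin n → ℕ} → (∀ j → j ≢ i → f j ≡ g j) →
  sumFin n f + g i ≡ sumFin n g + f i
sumFin-update (suc n) zero {f} {g} f≗g =
  begin
    (f zero + sumFin n (λ j → f (suc j))) + g zero
  ≡⟨ cong (λ s → (f zero + s) + g zero) (sumFin-cong n (λ j → f≗g (suc j) (λ ()))) ⟩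
    (f zero + sumFin n (λ j → g (suc j))) + g zero
  ≡⟨ solve 3 (λ x s y → (x :+ s) :+ y := (y :+ s) :+ x) refl (f zero) _ (g zero) ⟩
    (g zero + sumFin n (λ j → g (suc j))) + f zero
  ∎
  where open ≡-Reasoning; open +-*-Solver
sumFin-update (suc n) (suc i) {f} {g} f≗g =
  begin
    (f zero + sumFin n (λ j → f (suc j))) + g (suc i)
  ≡⟨ +-assoc (f zero) _ _ ⟩
    f zero + (sumFin n (λ j → f (suc j)) + g (suc i))
  ≡⟨ cong₂ _+_ (f≗g zero (λ ()))
       (sumFin-update n i (λ j j≢i → f≗g (suc j) (j≢i ∘ suc-injective))) ⟩
    g zero + (sumFin n (λ j → g (suc j)) + f (suc i))
  ≡⟨ sym (+-assoc (g zero) _ _) ⟩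
    (g zero + sumFin n (λ j → g (suc j))) + f (suc i)
  ∎
  where open ≡-Reasoning

wIn-cong : ∀ {k} (C D : VSet k) x → C x ≡ D x → wIn C x ≡ wIn D x
wIn-cong C D x = cong (λ b → if b then w x else 0)

wIn-present : ∀ {k} (C : VSet k) x → C x ≡ true → wIn C x ≡ w x
wIn-present C x Cx rewrite Cx = refl

wIn-absent : ∀ {k} (C : VSet k) x → C x ≡ false → wIn C x ≡ 0
wIn-absent C x Cx rewrite Cx = refl

Adj-leaf : ∀ {k} {x : Vertex k} {j} → Adj x (d j) → x ≡ a j
Adj-leaf (ad _) = refl

Path-start : ∀ {k} {D : VSet k} {x y} → Path D x y → D x ≡ false
Path-start (here Dx) = Dx
Path-start (step Dx _ _) = Dx

Path-end : ∀ {k} {D : VSet k} {x y} → Path D x y → D y ≡ false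
Path-end (here Dy) = Dy
Path-end (step _ _ p) = Path-end p

-- A path avoiding a_j can only visit the leaf d_j as its first vertex.
Path-transfer : ∀ {k} {D C : VSet k} (j : Fin k) → D (a j) ≡ true →
  (∀ z → z ≢ d j → D z ≡ false → C z ≡ false) →
  ∀ {x y} → x ≢ d j → Path D x y → Path C x y
Path-transfer j Daj D⇒C x≢dj (here Dx) = here (D⇒C _ x≢dj Dx)
Path-transfer j Daj D⇒C x≢dj (step Dx x~y p) =
  step (D⇒C _ x≢dj Dx) x~y (Path-transfer j Daj D⇒C y≢dj p)
  where
  y≢dj : _ ≢ d j
  y≢dj refl with Adj-leaf x~y
  ... | refl with trans (sym Daj) Dx
  ...   | ()

module _ {k : ℕ} (i : Fin k) (C : VSet k) where

  tradeDForA : VSet k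
  tradeDForA (a j) with j ≟ i
  ... | yes _ = true
  ... | no  _ = C (a j)
  tradeDForA (d j) with j ≟ i
  ... | yes _ = false
  ... | no  _ = C (d j)
  tradeDForA (v j l) = C (v j l)

  trade-a : tradeDForA (a i) ≡ true
  trade-a with i ≟ i
  ... | yes _   = refl
  ... | no  i≢i = ⊥-elim (i≢i refl)

  trade-d : tradeDForA (d i) ≡ false
  trade-d with i ≟ i
  ... | yes _   = refl
  ... | no  i≢i = ⊥-elim (i≢i refl)

  trade-a-other : ∀ j → j ≢ i → tradeDForA (a j) ≡ C (a j)
  trade-a-other j j≢i with j ≟ i
  ... | yes j≡i = ⊥-elim (j≢i j≡i)
  ... | no  _   = refl

  trade-d-other : ∀ j → j ≢ i → tradeDForA (d j) ≡ C (d j)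
  trade-d-other j j≢i with j ≟ i
  ... | yes j≡i = ⊥-elim (j≢i j≡i)
  ... | no  _   = refl

  trade-avoids : ∀ z → z ≢ d i → tradeDForA z ≡ false → C z ≡ false
  trade-avoids (a j) _ T≡false with j ≟ i
  trade-avoids (a j) _ () | yes _
  ... | no  _ = T≡false
  trade-avoids (d j) z≢di T≡false with j ≟ i
  ... | yes refl = ⊥-elim (z≢di refl)
  ... | no  _    = T≡false
  trade-avoids (v j l) _ T≡false = T≡false

  trade-isCut : ∀ {X B} → X (d i) ≡ false →
    IsCut (InX X) B C → IsCut (InX X) B tradeDForA
  trade-isCut Xdi≡false cut x y x∈X _ y∈B _ p =
    cut x y x∈X (Path-start q) y∈B (Path-end q) q
    where
    x≢di : x ≢ d i
    x≢di refl with trans (sym (proj₂ x∈X)) Xdi≡false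
    ... | ()
    q : Path C x y
    q = Path-transfer i trade-a trade-avoids x≢di p

  trade-weight : C (a i) ≡ false → C (d i) ≡ true → weight tradeDForA + 2 ≡ weight C
  trade-weight Cai Cdi =
    begin
      (A′ + D′ + V) + 2   ≡⟨ cong (λ s → (s + D′ + V) + 2) A′≡A+2 ⟩
      (A + 2 + D′ + V) + 2
        ≡⟨ solve 3 (λ x y z → (x :+ con 2 :+ y :+ z) :+ con 2 := x :+ (y :+ con 4) :+ z)
             refl A D′ V ⟩
      A + (D′ + 4) + V    ≡⟨ cong (λ s → A + s + V) D′+4≡D ⟩
      A + D + V
    ∎
    where
    open ≡-Reasoning
    open +-*-Solver
    A A′ D D′ V : ℕ
    A  = sumFin k (λ j → wIn C (a j))
    A′ = sumFin k (λ j → wIn tradeDForA (a j))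
    D  = sumFin k (λ j → wIn C (d j))
    D′ = sumFin k (λ j → wIn tradeDForA (d j))
    V  = sumFin k (λ j → sumFin (toℕ j) (λ l → wIn C (v j l)))
    A′≡A+2 : A′ ≡ A + 2
    A′≡A+2 =
      begin
        A′                       ≡⟨ sym (+-identityʳ A′) ⟩
        A′ + 0                   ≡⟨ cong (A′ +_) (sym (wIn-absent C (a i) Cai)) ⟩
        A′ + wIn C (a i)         ≡⟨ sumFin-update k i (λ j j≢i →
                                      wIn-cong tradeDForA C (a j) (trade-a-other j j≢i)) ⟩
        A + wIn tradeDForA (a i) ≡⟨ cong (A +_) (wIn-present tradeDForA (a i) trade-a) ⟩
        A + 2
      ∎
    D′+4≡D : D′ + 4 ≡ D
    D′+4≡D =
      begin
        D′ + 4                   ≡⟨ cong (D′ +_) (sym (wIn-present C (d i) Cdi)) ⟩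
        D′ + wIn C (d i)         ≡⟨ sumFin-update k i (λ j j≢i →
                                      wIn-cong tradeDForA C (d j) (trade-d-other j j≢i)) ⟩
        D + wIn tradeDForA (d i) ≡⟨ cong (D +_) (wIn-absent tradeDForA (d i) trade-d) ⟩
        D + 0                    ≡⟨ +-identityʳ D ⟩
        D
      ∎

lemma4p2 : (k : ℕ) → 1 ≤ k → (i : Fin k) → (X : VSet k) →
    (∀ x → X x ≡ true → IsTerminal x) →
    X (a i) ≡ true → X (d i) ≡ false →
    (C : VSet k) → IsMinCut (InX X) (InTminusX X) C → C (a i) ≡ true
lemma4p2 k _ i X _ Xai Xdi C (cut , minimal) with C (a i) in Cai
... | true = refl
... | false with C (d i) in Cdi
...   | false = ⊥-elim (cut (a i) (d i) (term-a i , Xai) Cai (term-d i , Xdi) Cdi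
                          (step Cai (ad i) (here Cdi)))
...   | true  = ⊥-elim (<⇒≱ lighter (minimal C′ (trade-isCut i C Xdi cut)))
  where
  C′ : VSet k
  C′ = tradeDForA i C
  lighter : weight C′ < weight C
  lighter = subst (weight C′ <_) (trade-weight i C Cai Cdi) (m<m+n (weight C′) (s≤s z≤n))
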